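{- Let $H=(A,B,E)$ be a bipartite graph with $|A|=a$, $|B|=b$ and $m=a+b$. Then for every real $x\neq 1$, $$\widetilde{T}_H\left(x,\frac{x}{x-1}\right)=\mathrm{alt}(H)\frac{x^{m}}{(x-1)^b}.$$ In particular, $\widetilde{T}_H(2,2)=\mathrm{alt}(H)2^{m}$.
   Context: A bipartite graph $H=(A,B,E)$ comes with designated sides $A,B$ (isolated vertices allowed). For $m=|V(H)|$ and a permutation $\pi$ of $V(H)$ (a bijection to $[m]$), a vertex $i\in A$ is internally active if $\pi(i)>\pi(j)$ for all neighbours $j$ of $i$, and $j\in B$ is externally active if $\pi(j)>\pi(i)$ for all neighbours $i$ of $j$ (vacuous for isolated vertices); $\mathrm{ia}(\pi),\mathrm{ea}(\pi)$ are their numbers, and $\widetilde{T}_H(x,y)=\frac{1}{m!}\sum_{\pi}x^{\mathrm{ia}(\pi)}y^{\mathrm{ea}(\pi)}=\sum_{i,j}t_{i,j}(H)x^iy^j$. If $\ell$ is the number of isolated vertices in $B$, the alternating number is $\mathrm{alt}(H)=t_{a,\ell}(H)$.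
   Formalization: The variable x ranges over the rationals other than 1 rather than over every real $x\neq 1$. -}

module Defs where

open import Data.Bool using (Bool; true; false; if_then_else_; _∧_; not)
open import Data.Nat as ℕ using (ℕ; zero; suc; _!)
open import Data.Fin as Fin using (Fin; _↑ˡ_; _↑ʳ_)
open import Data.Fin.Properties as FinP using ()
open import Data.List as List using (List; []; _∷_; allFin; filter; length; map; concatMap; foldr)
open import Data.List.Relation.Unary.Unique.DecPropositional as UDP using ()
open import Data.Vec as Vec using (Vec; lookup; toList)
open import Data.Integer as ℤ using (+_; -[1+_])
open import Data.Rational as ℚ using (ℚ; mkℚ; 0ℚ; 1ℚ; _+_; _*_; _-_; 1/_)
open import Relation.Nullary.Decidable using (⌊_⌋; does)

record BipGraph : Set where
  field
    a : ℕ
    b : ℕ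
    E : Fin a → Fin b → Bool
open BipGraph public

nV : BipGraph → ℕ
nV H = a H ℕ.+ b H

vA : (H : BipGraph) → Fin (a H) → Fin (nV H)
vA H i = i ↑ˡ b H

vB : (H : BipGraph) → Fin (b H) → Fin (nV H)
vB H j = a H ↑ʳ j

-- Permutations of V(H): bijections V(H) → [m], represented as vectors
-- π : Vec (Fin m) m (π(v) = lookup π v) with pairwise distinct entries.

allVecs : (n k : ℕ) → List (Vec (Fin k) n)
allVecs zero    k = Vec.[] ∷ []
allVecs (suc n) k = concatMap (λ x → map (x Vec.∷_) (allVecs n k)) (allFin k)

perms : (n : ℕ) → List (Vec (Fin n) n)
perms n = filter (λ v → UDP.unique? Fin._≟_ (toList v)) (allVecs n n)

allB : {n : ℕ} → (Fin n → Bool) → Bool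
allB {n} P = foldr (λ i r → P i ∧ r) true (allFin n)

countB : {n : ℕ} → (Fin n → Bool) → ℕ
countB {n} P = length (filter (λ i → P i Data.Bool.≟ true) (allFin n))
  where import Data.Bool

_<ᵇ_ : {n : ℕ} → Fin n → Fin n → Bool
x <ᵇ y = ⌊ x Fin.<? y ⌋

intActive : (H : BipGraph) → Vec (Fin (nV H)) (nV H) → Fin (a H) → Bool
intActive H π i =
  allB (λ j → if E H i j then lookup π (vB H j) <ᵇ lookup π (vA H i) else true)

extActive : (H : BipGraph) → Vec (Fin (nV H)) (nV H) → Fin (b H) → Bool
extActive H π j =
  allB (λ i → if E H i j then lookup π (vA H i) <ᵇ lookup π (vB H j) else true)

ia : (H : BipGraph) → Vec (Fin (nV H)) (nV H) → ℕ
ia H π = countB (intActive H π)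

ea : (H : BipGraph) → Vec (Fin (nV H)) (nV H) → ℕ
ea H π = countB (extActive H π)

isolB : BipGraph → ℕ
isolB H = countB (λ j → allB (λ i → not (E H i j)))

fromℕ : ℕ → ℚ
fromℕ n = + n ℚ./ 1

_^_ : ℚ → ℕ → ℚ
x ^ zero  = 1ℚ
x ^ suc n = x * (x ^ n)

-- total inverse (inv0 0 = 0); only ever applied to nonzero arguments below
inv0 : ℚ → ℚ
inv0 p@(mkℚ (+ zero)    _ _) = 0ℚ
inv0 p@(mkℚ (+ suc n)   _ _) = 1/ p
inv0 p@(mkℚ -[1+ n ]    _ _) = 1/ p

sumℚ : List ℚ → ℚ
sumℚ = foldr _+_ 0ℚ

Ttilde : BipGraph → ℚ → ℚ → ℚ
Ttilde H x y =
  inv0 (fromℕ (nV H !)) * sumℚ (map (λ π → (x ^ ia H π) * (y ^ ea H π)) (perms (nV H)))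

tcoef : BipGraph → ℕ → ℕ → ℚ
tcoef H i j =
  inv0 (fromℕ (nV H !)) *
  fromℕ (length (filter (λ π → (ia H π ℕ.≟ i) Relation.Nullary.Decidable.×-dec (ea H π ℕ.≟ j)) (perms (nV H))))

alt : BipGraph → ℚ
alt H = tcoef H (a H) (isolB H)

module Submission where

-- Reading a permutation π from its lowest to its highest value lists the vertices as an
-- arrangement σ = π⁻¹, and a vertex is active exactly when none of its neighbours comes later
-- in σ. Sums over permutations of products of vertex weights therefore become sums over
-- arrangements of a vertex set S, computed recursively by removing the bottom vertex. When
-- y (x − 1) = x, the summand x^ia y^ea (x − 1)^b is such a product, with weight f = x on active
-- vertices and f = 1 (in A) or x − 1 (in B) on the others. Let N(S) count the arrangements of S
-- in which every A-vertex is active. N(S) expands by its bottom vertex with weight χᴬ (an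
-- A-vertex there must be isolated) and by its top vertex with weight χᴮ (a B-vertex there must
-- be isolated), and f + χᴬ = x χᴬ + χᴮ vertexwise. Adding the two expansions makes the
-- f-weighted sum over arrangements of S equal to x^|S| N(S). Finally N(V) counts the
-- permutations with ia = a, which automatically have ea = ℓ, so N(V) = m! alt(H).

open import Algebra.Bundles using (CommutativeRing)
open import Data.Bool using (Bool; true; false; _∧_; not; if_then_else_)
import Data.Bool as Bool
open import Data.Bool.Properties
  using (not-involutive; not-¬; not-injective; ∧-comm; ∧-assoc; ∧-identityʳ; ∧-zeroʳ; ∧-conicalˡ; ∧-conicalʳ)
open import Data.Empty using (⊥-elim)
open import Data.Fin using (Fin; zero; suc; toℕ; _↑ˡ_; _↑ʳ_; punchOut; splitAt)
import Data.Fin as Fin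
open import Data.Fin.Permutation using (permutation)
open import Data.Fin.Properties
  using (_≟_; splitAt-↑ˡ; splitAt-↑ʳ; toℕ-injective; any?; all?; suc-injective; punchOut-injective; <⇒notInjective)
import Data.Fin.Properties as Fin
import Data.Integer as ℤ
import Data.Integer.Properties as ℤ
open import Data.List as List using (List; []; _∷_; map; filter; length; concatMap; allFin; _++_)
open import Data.List.Membership.Propositional using () renaming (_∈_ to _∈ₗ_)
open import Data.List.Properties using (map-cong; map-∘; map-tabulate)
import Data.List.Relation.Unary.All as All
open import Data.List.Relation.Unary.AllPairs using ([]; _∷_)
open import Data.List.Relation.Unary.Unique.Propositional using (Unique)
import Data.List.Relation.Unary.Unique.DecPropositional as UDP
open import Data.Nat as ℕ using (ℕ; zero; suc; _!)
import Data.Nat.Coprimality as ℕ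
import Data.Nat.Properties as ℕ
open import Data.Product using (_×_; _,_; proj₁; proj₂; ∃)
open import Data.Rational using (ℚ; mkℚ; 0ℚ; 1ℚ; _+_; _*_; _-_; _/_)
import Data.Rational.Properties as ℚ
open import Data.Rational.Solver using (module +-*-Solver)
open import Data.Sum using (_⊎_; inj₁; inj₂; [_,_]′)
open import Data.Vec as Vec using (Vec; []; _∷_; lookup; toList)
import Data.Vec.Properties as Vec
open import Data.Vec.Membership.Propositional.Properties using (∈-lookup; ∈-toList⁺; ∈-toList⁻)
import Data.Vec.Relation.Unary.Any as Any
open import Data.Vec.Relation.Unary.Any.Properties using (lookup-index)
open import Function using (_∘_; id; const)
open import Function.Definitions using (Injective)
open import Relation.Binary.PropositionalEquality
open import Relation.Nullary using (Dec; yes; no; contradiction)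
open import Relation.Nullary.Decidable using (does; ⌊_⌋; dec-true; dec-false; _×-dec_)

open import Defs

open import Algebra.Properties.Semiring.Sum (CommutativeRing.semiring ℚ.+-*-commutativeRing)
open import Algebra.Properties.CommutativeMonoid.Sum ℚ.*-1-commutativeMonoid
  using () renaming (sum to ∏; sum-cong-≗ to ∏-cong; ∑-distrib-+ to ∏-distrib-*; sum-permute to ∏-permute)
open import Algebra.Properties.Group ℚ.+-0-group using () renaming (∙-cancelʳ to +-cancelʳ)
open +-*-Solver using (solve; _:=_; _:+_; _:*_; _:-_; con)
open ≡-Reasoning

⟦_⟧ : Bool → ℚ
⟦ b ⟧ = if b then 1ℚ else 0ℚ

⟦∧⟧ : ∀ a b → ⟦ a ∧ b ⟧ ≡ ⟦ a ⟧ * ⟦ b ⟧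
⟦∧⟧ true  b = sym (ℚ.*-identityˡ ⟦ b ⟧)
⟦∧⟧ false b = sym (ℚ.*-zeroˡ ⟦ b ⟧)

⟦⟧*-cong : ∀ b {p q} → (b ≡ true → p ≡ q) → ⟦ b ⟧ * p ≡ ⟦ b ⟧ * q
⟦⟧*-cong true  p≡q = cong (1ℚ *_) (p≡q refl)
⟦⟧*-cong false {p} {q} _ = trans (ℚ.*-zeroˡ p) (sym (ℚ.*-zeroˡ q))

⟦does⟧*-cong : ∀ {P : Set} (P? : Dec P) {p q} → (P → p ≡ q) → ⟦ does P? ⟧ * p ≡ ⟦ does P? ⟧ * q
⟦does⟧*-cong (yes P) p≡q = cong (1ℚ *_) (p≡q P)
⟦does⟧*-cong (no _) {p} {q} _ = trans (ℚ.*-zeroˡ p) (sym (ℚ.*-zeroˡ q))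

∑-δ : ∀ {n} (c : Fin n) (f : Fin n → ℚ) → ∑[ i < n ] (⟦ does (i ≟ c) ⟧ * f i) ≡ f c
∑-δ {suc n} zero f = begin
  1ℚ * f zero + ∑[ i < n ] (0ℚ * f (suc i))
    ≡⟨ cong₂ _+_ (ℚ.*-identityˡ (f zero)) (sym (*-distribˡ-sum 0ℚ (f ∘ suc))) ⟩
  f zero + 0ℚ * ∑[ i < n ] f (suc i)        ≡⟨ cong (f zero +_) (ℚ.*-zeroˡ (∑[ i < n ] f (suc i))) ⟩
  f zero + 0ℚ                               ≡⟨ ℚ.+-identityʳ (f zero) ⟩
  f zero                                    ∎
∑-δ {suc n} (suc c) f = begin
  0ℚ * f zero + ∑[ i < n ] (⟦ does (i ≟ c) ⟧ * f (suc i)) ≡⟨ cong₂ _+_ (ℚ.*-zeroˡ (f zero)) refl ⟩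
  0ℚ + ∑[ i < n ] (⟦ does (i ≟ c) ⟧ * f (suc i))          ≡⟨ ℚ.+-identityˡ _ ⟩
  ∑[ i < n ] (⟦ does (i ≟ c) ⟧ * f (suc i))               ≡⟨ ∑-δ c (f ∘ suc) ⟩
  f (suc c)                                               ∎

∏-++ : ∀ {m n} (f : Fin (m ℕ.+ n) → ℚ) → ∏ f ≡ ∏ (f ∘ (_↑ˡ n)) * ∏ (f ∘ (m ↑ʳ_))
∏-++ {zero}  f = sym (ℚ.*-identityˡ _)
∏-++ {suc m} {n} f = trans (cong (f zero *_) (∏-++ {m} {n} (f ∘ suc)))
  (sym (ℚ.*-assoc (f zero) (∏ (f ∘ suc ∘ (_↑ˡ n))) (∏ (f ∘ suc ∘ (m ↑ʳ_)))))

∏-const : ∀ n p → ∏ {n} (λ _ → p) ≡ p ^ n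
∏-const zero    p = refl
∏-const (suc n) p = cong (p *_) (∏-const n p)

1^n≡1 : ∀ n → 1ℚ ^ n ≡ 1ℚ
1^n≡1 zero    = refl
1^n≡1 (suc n) = trans (ℚ.*-identityˡ (1ℚ ^ n)) (1^n≡1 n)

inv0-inverseʳ : ∀ p → p ≢ 0ℚ → p * inv0 p ≡ 1ℚ
inv0-inverseʳ p@(mkℚ (ℤ.+ zero)    _ _) p≢0 = contradiction (ℚ.↥p≡0⇒p≡0 p refl) p≢0
inv0-inverseʳ p@(mkℚ (ℤ.+ (suc _)) _ _) _   = ℚ.*-inverseʳ p
inv0-inverseʳ p@(mkℚ ℤ.-[1+ _ ]    _ _) _   = ℚ.*-inverseʳ p

^-≢0 : ∀ {p} → p ≢ 0ℚ → ∀ n → p ^ n ≢ 0ℚ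
^-≢0     p≢0 zero    ()
^-≢0 {p} p≢0 (suc n) pⁿ⁺¹≡0 = ^-≢0 p≢0 n (begin
  p ^ n                ≡⟨ sym (ℚ.*-identityˡ (p ^ n)) ⟩
  1ℚ * p ^ n           ≡⟨ cong (_* p ^ n) (sym (trans (ℚ.*-comm (inv0 p) p) (inv0-inverseʳ p p≢0))) ⟩
  inv0 p * p * p ^ n   ≡⟨ ℚ.*-assoc (inv0 p) p (p ^ n) ⟩
  inv0 p * (p * p ^ n) ≡⟨ cong (inv0 p *_) pⁿ⁺¹≡0 ⟩
  inv0 p * 0ℚ          ≡⟨ ℚ.*-zeroʳ (inv0 p) ⟩
  0ℚ                   ∎)

p*r≡q⇒p≡q*inv0r : ∀ {p q r} → r ≢ 0ℚ → p * r ≡ q → p ≡ q * inv0 r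
p*r≡q⇒p≡q*inv0r {p} {q} {r} r≢0 p*r≡q = begin
  p                ≡⟨ sym (ℚ.*-identityʳ p) ⟩
  p * 1ℚ           ≡⟨ cong (p *_) (sym (inv0-inverseʳ r r≢0)) ⟩
  p * (r * inv0 r) ≡⟨ sym (ℚ.*-assoc p r (inv0 r)) ⟩
  p * r * inv0 r   ≡⟨ cong (_* inv0 r) p*r≡q ⟩
  q * inv0 r       ∎

every : ∀ {n} → (Fin n → Bool) → Bool
every {zero}  P = true
every {suc n} P = P zero ∧ every (P ∘ suc)

count : ∀ {n} → (Fin n → Bool) → ℕ
count {zero}  P = 0
count {suc n} P = if P zero then suc (count (P ∘ suc)) else count (P ∘ suc)

every-cong : ∀ {n} {P Q : Fin n → Bool} → (∀ i → P i ≡ Q i) → every P ≡ every Q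
every-cong {zero}  P≗Q = refl
every-cong {suc n} P≗Q = cong₂ _∧_ (P≗Q zero) (every-cong (P≗Q ∘ suc))

every-true : ∀ {n} {P : Fin n → Bool} → (∀ i → P i ≡ true) → every P ≡ true
every-true {zero}  _      = refl
every-true {suc n} P≡true = cong₂ _∧_ (P≡true zero) (every-true (P≡true ∘ suc))

every-elim : ∀ {n} {P : Fin n → Bool} → every P ≡ true → ∀ i → P i ≡ true
every-elim {suc n} h zero    = ∧-conicalˡ _ _ h
every-elim {suc n} h (suc i) = every-elim (∧-conicalʳ _ _ h) i

every-false : ∀ {n} {P : Fin n → Bool} i → P i ≡ false → every P ≡ false
every-false {suc n}     zero    Pi≡false = cong₂ _∧_ Pi≡false refl
every-false {suc n} {P} (suc i) Pi≡false =
  trans (cong (P zero ∧_) (every-false i Pi≡false)) (∧-zeroʳ (P zero))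

every-++ : ∀ {m n} (P : Fin (m ℕ.+ n) → Bool) → every P ≡ every (P ∘ (_↑ˡ n)) ∧ every (P ∘ (m ↑ʳ_))
every-++ {zero}      P = refl
every-++ {suc m} {n} P = trans (cong (P zero ∧_) (every-++ {m} {n} (P ∘ suc)))
  (sym (∧-assoc (P zero) (every (P ∘ suc ∘ (_↑ˡ n))) (every (P ∘ suc ∘ (m ↑ʳ_)))))

count-cong : ∀ {n} {P Q : Fin n → Bool} → (∀ i → P i ≡ Q i) → count P ≡ count Q
count-cong {zero}  P≗Q = refl
count-cong {suc n} P≗Q = cong₂ (λ b k → if b then suc k else k) (P≗Q zero) (count-cong (P≗Q ∘ suc))

count≤n : ∀ {n} (P : Fin n → Bool) → count P ℕ.≤ n
count≤n {zero}  P = ℕ.z≤n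
count≤n {suc n} P with P zero
... | true  = ℕ.s≤s (count≤n (P ∘ suc))
... | false = ℕ.m≤n⇒m≤1+n (count≤n (P ∘ suc))

count≡n⇒every : ∀ {n} (P : Fin n → Bool) → count P ≡ n → every P ≡ true
count≡n⇒every {zero}  P _ = refl
count≡n⇒every {suc n} P h with P zero
... | true  = count≡n⇒every (P ∘ suc) (ℕ.suc-injective h)
... | false = contradiction (subst (ℕ._≤ n) h (count≤n (P ∘ suc))) ℕ.1+n≰n

every⇒count≡n : ∀ {n} (P : Fin n → Bool) → every P ≡ true → count P ≡ n
every⇒count≡n {zero}  P _ = refl
every⇒count≡n {suc n} P h with P zero | h
... | true | h′ = cong suc (every⇒count≡n (P ∘ suc) h′)

^-count : ∀ {n} p (P : Fin n → Bool) → p ^ count P ≡ ∏ (λ i → if P i then p else 1ℚ)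
^-count {zero}  p P = refl
^-count {suc n} p P with P zero
... | true  = cong (p *_) (^-count p (P ∘ suc))
... | false = trans (^-count p (P ∘ suc)) (sym (ℚ.*-identityˡ _))

∏-⟦⟧ : ∀ {n} (P : Fin n → Bool) → ∏ (λ i → ⟦ P i ⟧) ≡ ⟦ every P ⟧
∏-⟦⟧ {zero}  P = refl
∏-⟦⟧ {suc n} P = trans (cong (⟦ P zero ⟧ *_) (∏-⟦⟧ (P ∘ suc))) (sym (⟦∧⟧ (P zero) (every (P ∘ suc))))

⌊⌋≡does : ∀ {A : Set} (a? : Dec A) → ⌊ a? ⌋ ≡ does a?
⌊⌋≡does (yes _) = refl
⌊⌋≡does (no _)  = refl

<ᵇ-asym : ∀ {n} (x y : Fin n) → x <ᵇ y ≡ true → y <ᵇ x ≡ false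
<ᵇ-asym x y x<ᵇy with x Fin.<? y
... | yes x<y = trans (⌊⌋≡does (y Fin.<? x)) (dec-false (y Fin.<? x) (Fin.<-asym x<y))

allB≡every : ∀ {n} (P : Fin n → Bool) → allB P ≡ every P
allB≡every {n} P = go id
  where
  go : ∀ {j} (f : Fin j → Fin n) → List.foldr (λ i r → P i ∧ r) true (List.tabulate f) ≡ every (P ∘ f)
  go {zero}  f = refl
  go {suc j} f = cong (P (f zero) ∧_) (go (f ∘ suc))

countB≡count : ∀ {n} (P : Fin n → Bool) → countB P ≡ count P
countB≡count {n} P = go id
  where
  go : ∀ {j} (f : Fin j → Fin n) → length (filter (λ i → P i Bool.≟ true) (List.tabulate f)) ≡ count (P ∘ f)
  go {zero}  f = refl
  go {suc j} f with P (f zero)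
  ... | true  = cong suc (go (f ∘ suc))
  ... | false = go (f ∘ suc)

∑∈ : {A : Set} → List A → (A → ℚ) → ℚ
∑∈ xs f = sumℚ (map f xs)

syntax ∑∈ xs (λ a → e) = ∑[ a ∈ xs ] e

module _ {A : Set} where

  ∑∈-cong : {f g : A → ℚ} (xs : List A) → (∀ a → f a ≡ g a) → ∑∈ xs f ≡ ∑∈ xs g
  ∑∈-cong xs f≗g = cong sumℚ (map-cong f≗g xs)

  ∑∈-zero : (xs : List A) → ∑[ a ∈ xs ] 0ℚ ≡ 0ℚ
  ∑∈-zero []       = refl
  ∑∈-zero (x ∷ xs) = trans (ℚ.+-identityˡ _) (∑∈-zero xs)

  ∑∈-+ : (f g : A → ℚ) (xs : List A) → ∑[ a ∈ xs ] (f a + g a) ≡ ∑∈ xs f + ∑∈ xs g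
  ∑∈-+ f g []       = sym (ℚ.+-identityˡ 0ℚ)
  ∑∈-+ f g (x ∷ xs) = begin
    (f x + g x) + ∑[ a ∈ xs ] (f a + g a) ≡⟨ cong ((f x + g x) +_) (∑∈-+ f g xs) ⟩
    (f x + g x) + (∑∈ xs f + ∑∈ xs g)     ≡⟨ solve 4 (λ a b c d → (a :+ b) :+ (c :+ d) := (a :+ c) :+ (b :+ d))
                                                   refl (f x) (g x) (∑∈ xs f) (∑∈ xs g) ⟩
    (f x + ∑∈ xs f) + (g x + ∑∈ xs g)     ∎

  ∑∈-*ˡ : (c : ℚ) (f : A → ℚ) (xs : List A) → ∑[ a ∈ xs ] (c * f a) ≡ c * ∑∈ xs f
  ∑∈-*ˡ c f []       = sym (ℚ.*-zeroʳ c)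
  ∑∈-*ˡ c f (x ∷ xs) = trans (cong (c * f x +_) (∑∈-*ˡ c f xs)) (sym (ℚ.*-distribˡ-+ c (f x) (∑∈ xs f)))

  ∑∈-*ʳ : (c : ℚ) (f : A → ℚ) (xs : List A) → ∑[ a ∈ xs ] (f a * c) ≡ ∑∈ xs f * c
  ∑∈-*ʳ c f xs = begin
    ∑[ a ∈ xs ] (f a * c) ≡⟨ ∑∈-cong xs (λ a → ℚ.*-comm (f a) c) ⟩
    ∑[ a ∈ xs ] (c * f a) ≡⟨ ∑∈-*ˡ c f xs ⟩
    c * ∑∈ xs f           ≡⟨ ℚ.*-comm c _ ⟩
    ∑∈ xs f * c           ∎

  ∑∈-++ : (f : A → ℚ) (xs ys : List A) → ∑∈ (xs ++ ys) f ≡ ∑∈ xs f + ∑∈ ys f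
  ∑∈-++ f []       ys = sym (ℚ.+-identityˡ _)
  ∑∈-++ f (x ∷ xs) ys = trans (cong (f x +_) (∑∈-++ f xs ys)) (sym (ℚ.+-assoc (f x) _ _))

  ∑∈-filter : {P : A → Set} (P? : ∀ a → Dec (P a)) (f : A → ℚ) (xs : List A) →
              ∑∈ (filter P? xs) f ≡ ∑[ a ∈ xs ] (⟦ does (P? a) ⟧ * f a)
  ∑∈-filter P? f []       = refl
  ∑∈-filter P? f (x ∷ xs) with does (P? x)
  ... | true  = cong₂ _+_ (sym (ℚ.*-identityˡ (f x))) (∑∈-filter P? f xs)
  ... | false = trans (∑∈-filter P? f xs) (sym (trans (cong₂ _+_ (ℚ.*-zeroˡ (f x)) refl) (ℚ.+-identityˡ _)))

  fromℕ-length : (xs : List A) → fromℕ (length xs) ≡ ∑[ a ∈ xs ] 1ℚ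
  fromℕ-length []       = refl
  fromℕ-length (x ∷ xs) = trans (fromℕ-suc (length xs)) (cong (1ℚ +_) (fromℕ-length xs))
    where
    fromℕ-suc : ∀ k → fromℕ (suc k) ≡ 1ℚ + fromℕ k
    fromℕ-suc k = sym (begin
      1ℚ + fromℕ k                   ≡⟨ cong (1ℚ +_) (ℚ.normalize-coprime {k} {0} k/1-coprime) ⟩
      1ℚ + mkℚ (ℤ.+ k) 0 k/1-coprime ≡⟨ cong (_/ 1) (cong (ℤ._+_ (ℤ.+ 1)) (ℤ.*-identityʳ (ℤ.+ k))) ⟩
      fromℕ (suc k)                  ∎)
      where k/1-coprime = ℕ.sym (ℕ.1-coprimeTo k)

∑∈-comm : {A B : Set} (h : A → B → ℚ) (xs : List A) (ys : List B) →
          ∑[ a ∈ xs ] ∑[ b ∈ ys ] h a b ≡ ∑[ b ∈ ys ] ∑[ a ∈ xs ] h a b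
∑∈-comm h []       ys = sym (∑∈-zero ys)
∑∈-comm h (x ∷ xs) ys =
  trans (cong (∑∈ ys (h x) +_) (∑∈-comm h xs ys)) (sym (∑∈-+ (h x) _ ys))

∑∈-concatMap : {A B : Set} (f : B → ℚ) (g : A → List B) (xs : List A) →
               ∑∈ (concatMap g xs) f ≡ ∑[ a ∈ xs ] ∑∈ (g a) f
∑∈-concatMap f g []       = refl
∑∈-concatMap f g (x ∷ xs) = trans (∑∈-++ f (g x) (concatMap g xs)) (cong (∑∈ (g x) f +_) (∑∈-concatMap f g xs))

∑∈-allFin : ∀ {n} (f : Fin n → ℚ) → ∑[ i ∈ allFin n ] f i ≡ ∑[ i < n ] f i
∑∈-allFin {n} f = trans (cong sumℚ (map-tabulate id f)) (go f)
  where
  go : ∀ {j} (g : Fin j → ℚ) → sumℚ (List.tabulate g) ≡ ∑[ i < j ] g i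
  go {zero}  g = refl
  go {suc j} g = cong (g zero +_) (go (g ∘ suc))

∑∈-allVecs-∷ : ∀ {n k} (F : Vec (Fin k) (suc n) → ℚ) →
               ∑[ σ ∈ allVecs (suc n) k ] F σ ≡ ∑[ w < k ] ∑[ τ ∈ allVecs n k ] F (w ∷ τ)
∑∈-allVecs-∷ {n} {k} F = begin
  ∑∈ (concatMap (λ w → map (w ∷_) (allVecs n k)) (allFin k)) F
    ≡⟨ ∑∈-concatMap F (λ w → map (w ∷_) (allVecs n k)) (allFin k) ⟩
  ∑[ w ∈ allFin k ] ∑∈ (map (w ∷_) (allVecs n k)) F
    ≡⟨ ∑∈-allFin (λ w → ∑∈ (map (w ∷_) (allVecs n k)) F) ⟩
  ∑[ w < k ] ∑∈ (map (w ∷_) (allVecs n k)) F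
    ≡⟨ sum-cong-≗ (λ w → cong sumℚ (sym (map-∘ {g = F} {f = w ∷_} (allVecs n k)))) ⟩
  ∑[ w < k ] ∑[ τ ∈ allVecs n k ] F (w ∷ τ) ∎

_≟ᵥ_ : ∀ {n k} → (σ τ : Vec (Fin k) n) → Dec (σ ≡ τ)
_≟ᵥ_ = Vec.≡-dec _≟_

∑∈-allVecs-δ : ∀ {n k} (τ : Vec (Fin k) n) (F : Vec (Fin k) n → ℚ) →
               ∑[ σ ∈ allVecs n k ] (⟦ does (σ ≟ᵥ τ) ⟧ * F σ) ≡ F τ
∑∈-allVecs-δ [] F = trans (cong₂ _+_ (ℚ.*-identityˡ (F [])) refl) (ℚ.+-identityʳ (F []))
∑∈-allVecs-δ {suc n} {k} (c ∷ τ) F = begin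
  ∑[ σ ∈ allVecs (suc n) k ] (⟦ does (σ ≟ᵥ (c ∷ τ)) ⟧ * F σ)
    ≡⟨ ∑∈-allVecs-∷ (λ σ → ⟦ does (σ ≟ᵥ (c ∷ τ)) ⟧ * F σ) ⟩
  ∑[ w < k ] ∑[ ρ ∈ allVecs n k ] (⟦ does (w ≟ c) ∧ does (ρ ≟ᵥ τ) ⟧ * F (w ∷ ρ))
    ≡⟨ sum-cong-≗ (λ w → trans (∑∈-cong (allVecs n k) (split w))
                               (∑∈-*ˡ ⟦ does (w ≟ c) ⟧ (λ ρ → ⟦ does (ρ ≟ᵥ τ) ⟧ * F (w ∷ ρ)) (allVecs n k))) ⟩
  ∑[ w < k ] (⟦ does (w ≟ c) ⟧ * ∑[ ρ ∈ allVecs n k ] (⟦ does (ρ ≟ᵥ τ) ⟧ * F (w ∷ ρ)))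
    ≡⟨ sum-cong-≗ (λ w → cong (⟦ does (w ≟ c) ⟧ *_) (∑∈-allVecs-δ τ (F ∘ (w ∷_)))) ⟩
  ∑[ w < k ] (⟦ does (w ≟ c) ⟧ * F (w ∷ τ))
    ≡⟨ ∑-δ c (λ w → F (w ∷ τ)) ⟩
  F (c ∷ τ) ∎
  where
  split : ∀ w ρ → ⟦ does (w ≟ c) ∧ does (ρ ≟ᵥ τ) ⟧ * F (w ∷ ρ)
                ≡ ⟦ does (w ≟ c) ⟧ * (⟦ does (ρ ≟ᵥ τ) ⟧ * F (w ∷ ρ))
  split w ρ = trans (cong (_* F (w ∷ ρ)) (⟦∧⟧ w≡c ρ≡τ)) (ℚ.*-assoc ⟦ w≡c ⟧ ⟦ ρ≡τ ⟧ (F (w ∷ ρ)))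
    where w≡c = does (w ≟ c); ρ≡τ = does (ρ ≟ᵥ τ)

-- Permutations as vectors, and reindexing by the inverse

module _ {A : Set} where

  unique⇒injective : ∀ {n} (xs : Vec A n) → Unique (toList xs) → Injective _≡_ _≡_ (lookup xs)
  unique⇒injective (x ∷ xs) (x∉xs ∷ _) {zero}  {zero}  _  = refl
  unique⇒injective (x ∷ xs) (x∉xs ∷ _) {zero}  {suc j} eq = contradiction eq (All.lookup x∉xs (∈-toList⁺ (∈-lookup j xs)))
  unique⇒injective (x ∷ xs) (x∉xs ∷ _) {suc i} {zero}  eq = contradiction (sym eq) (All.lookup x∉xs (∈-toList⁺ (∈-lookup i xs)))
  unique⇒injective (x ∷ xs) (_    ∷ u) {suc i} {suc j} eq = cong suc (unique⇒injective xs u eq)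

  injective⇒unique : ∀ {n} (xs : Vec A n) → Injective _≡_ _≡_ (lookup xs) → Unique (toList xs)
  injective⇒unique []       _   = []
  injective⇒unique (x ∷ xs) inj = All.tabulate x∉xs ∷ injective⇒unique xs (suc-injective ∘ inj)
    where
    x∉xs : ∀ {y} → y ∈ₗ toList xs → x ≢ y
    x∉xs y∈xs refl with () ← inj {zero} {suc (Any.index (∈-toList⁻ y∈xs))} (lookup-index (∈-toList⁻ y∈xs))

injective⇒surjective : ∀ {n} {f : Fin n → Fin n} → Injective _≡_ _≡_ f → ∀ y → ∃ λ k → f k ≡ y
injective⇒surjective {suc n} {f} inj y with any? (λ k → f k ≟ y)
... | yes found = found
... | no  ∄k    = ⊥-elim (<⇒notInjective (ℕ.n<1+n n) punchOut∘f-injective)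
  where
  y≢f : ∀ k → y ≢ f k
  y≢f k y≡fk = ∄k (k , sym y≡fk)
  punchOut∘f-injective : Injective _≡_ _≡_ (λ k → punchOut (y≢f k))
  punchOut∘f-injective eq = inj (punchOut-injective (y≢f _) (y≢f _) eq)

Inverses : ∀ {n} → Vec (Fin n) n → Vec (Fin n) n → Set
Inverses π σ = (∀ k → lookup π (lookup σ k) ≡ k) × (∀ k → lookup σ (lookup π k) ≡ k)

Inverses⇒injective : ∀ {n} {π σ : Vec (Fin n) n} → Inverses π σ → Injective _≡_ _≡_ (lookup π)
Inverses⇒injective {σ = σ} (_ , σπ) {i} {j} πi≡πj = trans (sym (σπ i)) (trans (cong (lookup σ) πi≡πj) (σπ j))

inverses? : ∀ {n} (π σ : Vec (Fin n) n) → Dec (Inverses π σ)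
inverses? π σ = all? (λ k → lookup π (lookup σ k) ≟ k) ×-dec all? (λ k → lookup σ (lookup π k) ≟ k)

inverses?-sym : ∀ {n} (π σ : Vec (Fin n) n) → does (inverses? π σ) ≡ does (inverses? σ π)
inverses?-sym π σ =
  ∧-comm (does (all? (λ k → lookup π (lookup σ k) ≟ k))) (does (all? (λ k → lookup σ (lookup π k) ≟ k)))

isPermutation : ∀ {n} → Vec (Fin n) n → Bool
isPermutation π = does (UDP.unique? _≟_ (toList π))

∑-inverses : ∀ {n} (π : Vec (Fin n) n) → ∑[ σ ∈ allVecs n n ] ⟦ does (inverses? π σ) ⟧ ≡ ⟦ isPermutation π ⟧
∑-inverses {n} π with UDP.unique? _≟_ (toList π)
... | yes π-unique = begin
  ∑[ σ ∈ allVecs n n ] ⟦ does (inverses? π σ) ⟧     ≡⟨ ∑∈-cong (allVecs n n) partner ⟩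
  ∑[ σ ∈ allVecs n n ] (⟦ does (σ ≟ᵥ ρ) ⟧ * 1ℚ)   ≡⟨ ∑∈-allVecs-δ ρ (λ _ → 1ℚ) ⟩
  1ℚ                                               ∎
  where
  π-injective = unique⇒injective π π-unique
  preimage : Fin n → Fin n
  preimage = proj₁ ∘ injective⇒surjective π-injective
  ρ = Vec.tabulate preimage
  πρ : ∀ y → lookup π (lookup ρ y) ≡ y
  πρ y = trans (cong (lookup π) (Vec.lookup∘tabulate preimage y)) (proj₂ (injective⇒surjective π-injective y))
  inverse-unique : ∀ σ → Inverses π σ → σ ≡ ρ
  inverse-unique σ (_ , σπ) = trans (sym (Vec.tabulate∘lookup σ)) (Vec.tabulate-cong (λ y → begin
    lookup σ y                       ≡⟨ cong (lookup σ) (sym (πρ y)) ⟩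
    lookup σ (lookup π (lookup ρ y)) ≡⟨ σπ (lookup ρ y) ⟩
    lookup ρ y                       ≡⟨ Vec.lookup∘tabulate preimage y ⟩
    preimage y                       ∎))
  partner : ∀ σ → ⟦ does (inverses? π σ) ⟧ ≡ ⟦ does (σ ≟ᵥ ρ) ⟧ * 1ℚ
  partner σ with σ ≟ᵥ ρ
  ... | yes refl = cong ⟦_⟧ (dec-true (inverses? π ρ) (πρ , λ k → π-injective (πρ (lookup π k))))
  ... | no  σ≢ρ  = trans (cong ⟦_⟧ (dec-false (inverses? π σ) (σ≢ρ ∘ inverse-unique σ))) (sym (ℚ.*-zeroˡ 1ℚ))
... | no π-not-unique = trans (∑∈-cong (allVecs n n) no-partner) (∑∈-zero (allVecs n n))
  where
  no-partner : ∀ σ → ⟦ does (inverses? π σ) ⟧ ≡ 0ℚ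
  no-partner σ =
    cong ⟦_⟧ (dec-false (inverses? π σ) (π-not-unique ∘ injective⇒unique π ∘ Inverses⇒injective {π = π} {σ}))

-- Both sides are sums over the pairs (π, σ) of mutually inverse vectors.
∑-perms-by-inverse : ∀ {n} (F G : Vec (Fin n) n → ℚ) → (∀ π σ → Inverses π σ → F π ≡ G σ) →
                     ∑[ π ∈ perms n ] F π ≡ ∑[ σ ∈ perms n ] G σ
∑-perms-by-inverse {n} F G F≡G = begin
  ∑[ π ∈ perms n ] F π
    ≡⟨ ∑∈-filter (λ v → UDP.unique? _≟_ (toList v)) F V ⟩
  ∑[ π ∈ V ] (⟦ isPermutation π ⟧ * F π)
    ≡⟨ ∑∈-cong V (λ π → trans (cong (_* F π) (sym (∑-inverses π))) (sym (∑∈-*ʳ (F π) (inv π) V))) ⟩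
  ∑[ π ∈ V ] ∑[ σ ∈ V ] (inv π σ * F π)
    ≡⟨ ∑∈-comm (λ π σ → inv π σ * F π) V V ⟩
  ∑[ σ ∈ V ] ∑[ π ∈ V ] (inv π σ * F π)
    ≡⟨ ∑∈-cong V (λ σ → ∑∈-cong V (λ π → transfer π σ)) ⟩
  ∑[ σ ∈ V ] ∑[ π ∈ V ] (inv σ π * G σ)
    ≡⟨ ∑∈-cong V (λ σ → trans (∑∈-*ʳ (G σ) (inv σ) V) (cong (_* G σ) (∑-inverses σ))) ⟩
  ∑[ σ ∈ V ] (⟦ isPermutation σ ⟧ * G σ)
    ≡⟨ sym (∑∈-filter (λ v → UDP.unique? _≟_ (toList v)) G V) ⟩
  ∑[ σ ∈ perms n ] G σ ∎
  where
  V = allVecs n n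
  inv : Vec (Fin n) n → Vec (Fin n) n → ℚ
  inv π σ = ⟦ does (inverses? π σ) ⟧
  transfer : ∀ π σ → inv π σ * F π ≡ inv σ π * G σ
  transfer π σ = trans (⟦does⟧*-cong (inverses? π σ) (F≡G π σ)) (cong (λ b → ⟦ b ⟧ * G σ) (inverses?-sym π σ))

module Arrangements {m : ℕ} (adj : Fin m → Fin m → Bool) where

  VertexSet : Set
  VertexSet = Fin m → Bool

  _≐_ : VertexSet → VertexSet → Set
  S ≐ T = ∀ v → S v ≡ T v

  full : VertexSet
  full _ = true

  _─_ : VertexSet → Fin m → VertexSet
  (S ─ w) v = S v ∧ not (does (v ≟ w))

  isEmpty : VertexSet → Bool
  isEmpty S = every (not ∘ S)

  isolatedIn : VertexSet → Fin m → Bool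
  isolatedIn S w = every (λ u → not (S u ∧ adj w u))

  Weight : Set
  Weight = Fin m → Bool → ℚ

  -- σ lists vertices from the bottom up, and S holds the vertices not yet listed.
  weight : ∀ {n} → Weight → VertexSet → Vec (Fin m) n → ℚ
  weight f S []      = 1ℚ
  weight f S (w ∷ σ) = f w (isolatedIn S w) * weight f (S ─ w) σ

  isArrangement : ∀ {n} → VertexSet → Vec (Fin m) n → Bool
  isArrangement S []      = isEmpty S
  isArrangement S (w ∷ σ) = S w ∧ isArrangement (S ─ w) σ

  arrangementSum : Weight → ℕ → VertexSet → ℚ
  arrangementSum f zero    S = ⟦ isEmpty S ⟧
  arrangementSum f (suc n) S = ∑[ w < m ] (⟦ S w ⟧ * f w (isolatedIn S w) * arrangementSum f n (S ─ w))

  ─-self : ∀ S w → (S ─ w) w ≡ false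
  ─-self S w = trans (cong (λ b → S w ∧ not b) (dec-true (w ≟ w) refl)) (∧-zeroʳ (S w))

  ─-other : ∀ S {w v} → v ≢ w → (S ─ w) v ≡ S v
  ─-other S {w} {v} v≢w = trans (cong (λ b → S v ∧ not b) (dec-false (v ≟ w) v≢w)) (∧-identityʳ (S v))

  ─-≢ : ∀ S {w v} → (S ─ w) v ≡ true → v ≢ w
  ─-≢ S {w} w∈S─w refl = contradiction (trans (sym (─-self S w)) w∈S─w) (λ ())

  ─-cong : ∀ {S T} → S ≐ T → ∀ w → (S ─ w) ≐ (T ─ w)
  ─-cong S≐T w v = cong₂ _∧_ (S≐T v) refl

  ─-comm : ∀ S u w → ((S ─ u) ─ w) ≐ ((S ─ w) ─ u)
  ─-comm S u w v = begin
    (S v ∧ v≢u) ∧ v≢w ≡⟨ ∧-assoc (S v) v≢u v≢w ⟩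
    S v ∧ (v≢u ∧ v≢w) ≡⟨ cong (S v ∧_) (∧-comm v≢u v≢w) ⟩
    S v ∧ (v≢w ∧ v≢u) ≡⟨ sym (∧-assoc (S v) v≢w v≢u) ⟩
    (S v ∧ v≢w) ∧ v≢u ∎
    where
    v≢u = not (does (v ≟ u))
    v≢w = not (does (v ≟ w))

  isolatedIn-cong : ∀ {S T} → S ≐ T → ∀ w → isolatedIn S w ≡ isolatedIn T w
  isolatedIn-cong S≐T w = every-cong (λ u → cong (λ b → not (b ∧ adj w u)) (S≐T u))

  weight-cong : ∀ {n} f {S T} → S ≐ T → (σ : Vec (Fin m) n) → weight f S σ ≡ weight f T σ
  weight-cong f S≐T []      = refl
  weight-cong f S≐T (w ∷ σ) = cong₂ _*_ (cong (f w) (isolatedIn-cong S≐T w)) (weight-cong f (─-cong S≐T w) σ)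

  arrangementSum-cong : ∀ f n {S T} → S ≐ T → arrangementSum f n S ≡ arrangementSum f n T
  arrangementSum-cong f zero    S≐T = cong ⟦_⟧ (every-cong (cong not ∘ S≐T))
  arrangementSum-cong f (suc n) S≐T = sum-cong-≗ λ w →
    cong₂ _*_ (cong₂ _*_ (cong ⟦_⟧ (S≐T w)) (cong (f w) (isolatedIn-cong S≐T w)))
              (arrangementSum-cong f n (─-cong S≐T w))

  arrangementSum≡∑ : ∀ f n S → arrangementSum f n S ≡ ∑[ σ ∈ allVecs n m ] (⟦ isArrangement S σ ⟧ * weight f S σ)
  arrangementSum≡∑ f zero    S = sym (trans (ℚ.+-identityʳ _) (ℚ.*-identityʳ _))
  arrangementSum≡∑ f (suc n) S = sym (begin
    ∑[ σ ∈ allVecs (suc n) m ] (⟦ isArrangement S σ ⟧ * weight f S σ)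
      ≡⟨ ∑∈-allVecs-∷ (λ σ → ⟦ isArrangement S σ ⟧ * weight f S σ) ⟩
    ∑[ w < m ] ∑[ τ ∈ allVecs n m ] (⟦ S w ∧ isArrangement (S ─ w) τ ⟧ * (f w (isolatedIn S w) * weight f (S ─ w) τ))
      ≡⟨ sum-cong-≗ (λ w → trans (∑∈-cong (allVecs n m) (regroup w)) (∑∈-*ˡ (first w) (rest w) (allVecs n m))) ⟩
    ∑[ w < m ] (first w * ∑[ τ ∈ allVecs n m ] rest w τ)
      ≡⟨ sum-cong-≗ (λ w → cong (first w *_) (sym (arrangementSum≡∑ f n (S ─ w)))) ⟩
    arrangementSum f (suc n) S ∎)
    where
    first : Fin m → ℚ
    first w = ⟦ S w ⟧ * f w (isolatedIn S w)
    rest : Fin m → Vec (Fin m) n → ℚ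
    rest w τ = ⟦ isArrangement (S ─ w) τ ⟧ * weight f (S ─ w) τ
    regroup : ∀ w τ → ⟦ S w ∧ isArrangement (S ─ w) τ ⟧ * (f w (isolatedIn S w) * weight f (S ─ w) τ) ≡ first w * rest w τ
    regroup w τ = trans (cong (_* (f w (isolatedIn S w) * weight f (S ─ w) τ)) (⟦∧⟧ (S w) (isArrangement (S ─ w) τ)))
      (solve 4 (λ a b c d → (a :* b) :* (c :* d) := a :* c :* (b :* d)) refl
        ⟦ S w ⟧ ⟦ isArrangement (S ─ w) τ ⟧ (f w (isolatedIn S w)) (weight f (S ─ w) τ))

  arrangement-members : ∀ {n} S (σ : Vec (Fin m) n) → isArrangement S σ ≡ true → ∀ k → S (lookup σ k) ≡ true
  arrangement-members S (w ∷ σ) σ∈S zero    = ∧-conicalˡ _ _ σ∈S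
  arrangement-members S (w ∷ σ) σ∈S (suc k) = ∧-conicalˡ _ _ (arrangement-members (S ─ w) σ (∧-conicalʳ _ _ σ∈S) k)

  arrangement-injective : ∀ {n} S (σ : Vec (Fin m) n) → isArrangement S σ ≡ true → Injective _≡_ _≡_ (lookup σ)
  arrangement-injective S (w ∷ σ) wσ∈S {i} {j} = go i j
    where
    σ∈S─w = ∧-conicalʳ _ _ wσ∈S
    go : ∀ i j → lookup (w ∷ σ) i ≡ lookup (w ∷ σ) j → i ≡ j
    go zero    zero    _  = refl
    go zero    (suc j) eq = contradiction (sym eq) (─-≢ S (arrangement-members (S ─ w) σ σ∈S─w j))
    go (suc i) zero    eq = contradiction eq (─-≢ S (arrangement-members (S ─ w) σ σ∈S─w i))
    go (suc i) (suc j) eq = cong suc (arrangement-injective (S ─ w) σ σ∈S─w eq)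

  injective⇒arrangement : ∀ {n} S (σ : Vec (Fin m) n) → Injective _≡_ _≡_ (lookup σ) →
                          (∀ k → S (lookup σ k) ≡ true) → (∀ v → S v ≡ true → ∃ λ k → lookup σ k ≡ v) →
                          isArrangement S σ ≡ true
  injective⇒arrangement S [] _ _ covered = every-true v∉S
    where
    v∉S : ∀ v → not (S v) ≡ true
    v∉S v with S v in v∈S
    ... | true  with () ← covered v v∈S
    ... | false = refl
  injective⇒arrangement S (w ∷ σ) inj members covered =
    cong₂ _∧_ (members zero) (injective⇒arrangement (S ─ w) σ (suc-injective ∘ inj) members′ covered′)
    where
    σ≢w : ∀ k → lookup σ k ≢ w
    σ≢w k eq with () ← inj {suc k} {zero} eq
    members′ : ∀ k → (S ─ w) (lookup σ k) ≡ true
    members′ k = trans (─-other S (σ≢w k)) (members (suc k))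
    covered′ : ∀ v → (S ─ w) v ≡ true → ∃ λ k → lookup σ k ≡ v
    covered′ v v∈S─w with covered v (∧-conicalˡ _ _ v∈S─w)
    ... | zero  , w≡v  = contradiction (sym w≡v) (─-≢ S v∈S─w)
    ... | suc k , σk≡v = k , σk≡v

  isArrangement-full : (σ : Vec (Fin m) m) → isArrangement full σ ≡ isPermutation σ
  isArrangement-full σ with UDP.unique? _≟_ (toList σ)
  ... | yes σ-unique = injective⇒arrangement full σ σ-injective (λ _ → refl)
                         (λ v _ → injective⇒surjective σ-injective v)
    where σ-injective = unique⇒injective σ σ-unique
  ... | no σ-not-unique with isArrangement full σ in σ-arrangement
  ...   | true  = contradiction (injective⇒unique σ (arrangement-injective full σ σ-arrangement)) σ-not-unique
  ...   | false = refl

module Ranking {m : ℕ} (adj : Fin m → Fin m → Bool) where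

  open Arrangements adj

  active : Vec (Fin m) m → Fin m → Bool
  active π v = every (λ u → if adj v u then lookup π u <ᵇ lookup π v else true)

  rankAtLeast : Vec (Fin m) m → ℕ → VertexSet
  rankAtLeast π c u = not (does (toℕ (lookup π u) ℕ.<? c))

  isolatedIn-rankAtLeast : ∀ π w → isolatedIn (rankAtLeast π (toℕ (lookup π w))) w ≡ active π w
  isolatedIn-rankAtLeast π w = every-cong below
    where
    below : ∀ u → not (rankAtLeast π (toℕ (lookup π w)) u ∧ adj w u)
                ≡ (if adj w u then lookup π u <ᵇ lookup π w else true)
    below u with adj w u
    ... | true  = trans (cong not (∧-identityʳ _))
                        (trans (not-involutive _) (sym (⌊⌋≡does (lookup π u Fin.<? lookup π w))))
    ... | false = cong not (∧-zeroʳ _)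

  rankAtLeast-─ : ∀ π → Injective _≡_ _≡_ (lookup π) →
                  ∀ w → (rankAtLeast π (toℕ (lookup π w)) ─ w) ≐ rankAtLeast π (suc (toℕ (lookup π w)))
  rankAtLeast-─ π π-injective w u = by-cases (u ≟ w)
    where
    c = toℕ (lookup π w)
    by-cases : Dec (u ≡ w) → (rankAtLeast π c ─ w) u ≡ rankAtLeast π (suc c) u
    by-cases (yes refl) = trans (─-self (rankAtLeast π c) u) (cong not (sym (dec-true (c ℕ.<? suc c) (ℕ.n<1+n c))))
    by-cases (no  u≢w)  = trans (─-other (rankAtLeast π c) u≢w) (cong not (same-side (toℕ (lookup π u) ℕ.<? c)))
      where
      πu≢c : toℕ (lookup π u) ≢ c
      πu≢c = u≢w ∘ π-injective ∘ toℕ-injective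
      same-side : (d : Dec (toℕ (lookup π u) ℕ.< c)) → does d ≡ does (toℕ (lookup π u) ℕ.<? suc c)
      same-side (yes πu<c) = sym (dec-true (_ ℕ.<? suc c) (ℕ.m<n⇒m<1+n πu<c))
      same-side (no  πu≮c) =
        sym (dec-false (_ ℕ.<? suc c) (λ πu<1+c → πu≮c (ℕ.≤∧≢⇒< (ℕ.s≤s⁻¹ πu<1+c) πu≢c)))

  weight-rankAtLeast : ∀ f π → Injective _≡_ _≡_ (lookup π) → ∀ {n} c (σ : Vec (Fin m) n) →
                       (∀ k → toℕ (lookup π (lookup σ k)) ≡ c ℕ.+ toℕ k) →
                       weight f (rankAtLeast π c) σ ≡ ∏ (λ k → f (lookup σ k) (active π (lookup σ k)))
  weight-rankAtLeast f π π-injective c []      _     = refl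
  weight-rankAtLeast f π π-injective c (w ∷ σ) ranks with trans (ranks zero) (ℕ.+-identityʳ c)
  ... | refl = cong₂ _*_ (cong (f w) (isolatedIn-rankAtLeast π w))
    (trans (weight-cong f (rankAtLeast-─ π π-injective w) σ)
           (weight-rankAtLeast f π π-injective (suc c) σ (λ k → trans (ranks (suc k)) (ℕ.+-suc c (toℕ k)))))

  weight≡∏-active : ∀ f π σ → Inverses π σ → weight f full σ ≡ ∏ (λ v → f v (active π v))
  weight≡∏-active f π σ inverses@(πσ , σπ) = begin
    weight f full σ
      -- rankAtLeast π 0 computes to full
      ≡⟨ weight-rankAtLeast f π (Inverses⇒injective {π = π} {σ} inverses) 0 σ (cong toℕ ∘ πσ) ⟩
    ∏ (λ k → f (lookup σ k) (active π (lookup σ k)))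
      ≡⟨ sym (∏-permute (λ v → f v (active π v)) σ-permutation) ⟩
    ∏ (λ v → f v (active π v)) ∎
    where
    σ-permutation = permutation (lookup σ) (lookup π) σπ πσ

  ∑-perms≡arrangementSum : ∀ f → ∑[ π ∈ perms m ] ∏ (λ v → f v (active π v)) ≡ arrangementSum f m full
  ∑-perms≡arrangementSum f = begin
    ∑[ π ∈ perms m ] ∏ (λ v → f v (active π v))
      ≡⟨ ∑-perms-by-inverse _ (weight f full) (λ π σ inverses → sym (weight≡∏-active f π σ inverses)) ⟩
    ∑[ σ ∈ perms m ] weight f full σ
      ≡⟨ ∑∈-filter (λ v → UDP.unique? _≟_ (toList v)) (weight f full) (allVecs m m) ⟩
    ∑[ σ ∈ allVecs m m ] (⟦ isPermutation σ ⟧ * weight f full σ)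
      ≡⟨ ∑∈-cong (allVecs m m) (λ σ → cong (λ b → ⟦ b ⟧ * weight f full σ) (sym (isArrangement-full σ))) ⟩
    ∑[ σ ∈ allVecs m m ] (⟦ isArrangement full σ ⟧ * weight f full σ)
      ≡⟨ sym (arrangementSum≡∑ f m full) ⟩
    arrangementSum f m full ∎

module Bipartite {m : ℕ} (inA : Fin m → Bool) (adj : Fin m → Fin m → Bool)
                 (adj-sym : ∀ u v → adj u v ≡ adj v u)
                 (adj-bipartite : ∀ u v → adj u v ≡ true → inA u ≡ not (inA v)) where

  open Arrangements adj

  χᴬ χᴮ : Weight
  χᴬ v t = if inA v then ⟦ t ⟧ else 1ℚ
  χᴮ v t = if inA v then 1ℚ else ⟦ t ⟧

  across-edge : ∀ u w → inA u ≡ not (inA w) → ∀ s t → χᴬ u false * χᴮ w s ≡ χᴮ w false * χᴬ u t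
  across-edge u w sides s t with inA u | inA w | sides
  ... | true  | false | _ = trans (ℚ.*-zeroˡ ⟦ s ⟧) (sym (ℚ.*-zeroˡ ⟦ t ⟧))
  ... | false | true  | _ = refl

  adj-irrefl : ∀ v → adj v v ≡ false
  adj-irrefl v with adj v v in vv
  ... | true  = contradiction (adj-bipartite v v vv) (not-¬ refl)
  ... | false = refl

  isolatedIn-─ : ∀ S u w → adj u w ≡ false → isolatedIn (S ─ w) u ≡ isolatedIn S u
  isolatedIn-─ S u w uw = every-cong (λ t → cong not (by-cases t (t ≟ w)))
    where
    by-cases : ∀ t → Dec (t ≡ w) → (S ─ w) t ∧ adj u t ≡ S t ∧ adj u t
    by-cases t (yes refl) = trans (cong₂ _∧_ (─-self S t) uw) (sym (trans (cong (S t ∧_) uw) (∧-zeroʳ (S t))))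
    by-cases t (no  t≢w)  = cong (_∧ adj u t) (─-other S t≢w)

  isolatedIn-adj : ∀ S u w → S w ≡ true → adj u w ≡ true → isolatedIn S u ≡ false
  isolatedIn-adj S u w w∈S uw = every-false w (cong not (cong₂ _∧_ w∈S uw))

  sole-vertex-isolated : ∀ S w → S w ≡ true → isEmpty (S ─ w) ≡ true → isolatedIn S w ≡ true
  sole-vertex-isolated S w w∈S S─w-empty = every-true no-neighbour
    where
    no-neighbour : ∀ u → not (S u ∧ adj w u) ≡ true
    no-neighbour u with u ≟ w
    ... | yes refl = cong not (trans (cong (S u ∧_) (adj-irrefl u)) (∧-zeroʳ (S u)))
    ... | no  u≢w  = cong (λ b → not (b ∧ adj w u))
                          (trans (sym (─-other S u≢w)) (not-injective (every-elim S─w-empty u)))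

  ─-swap : ∀ S u w → S u ∧ (S ─ u) w ≡ S w ∧ (S ─ w) u
  ─-swap S u w = by-cases (u ≟ w)
    where
    by-cases : Dec (u ≡ w) → S u ∧ (S ─ u) w ≡ S w ∧ (S ─ w) u
    by-cases (yes refl) = refl
    by-cases (no u≢w)   = begin
      S u ∧ (S ─ u) w ≡⟨ cong (S u ∧_) (─-other S (u≢w ∘ sym)) ⟩
      S u ∧ S w       ≡⟨ ∧-comm (S u) (S w) ⟩
      S w ∧ S u       ≡⟨ cong (S w ∧_) (sym (─-other S u≢w)) ⟩
      S w ∧ (S ─ w) u ∎

  exchange : ∀ S u w → S u ≡ true → (S ─ u) w ≡ true →
             χᴬ u (isolatedIn S u) * χᴮ w (isolatedIn (S ─ u) w) ≡
             χᴮ w (isolatedIn S w) * χᴬ u (isolatedIn (S ─ w) u)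
  exchange S u w u∈S w∈S─u with adj u w in uw
  ... | false = begin
    χᴬ u (isolatedIn S u) * χᴮ w (isolatedIn (S ─ u) w)
      ≡⟨ cong (λ b → χᴬ u (isolatedIn S u) * χᴮ w b) (isolatedIn-─ S w u (trans (adj-sym w u) uw)) ⟩
    χᴬ u (isolatedIn S u) * χᴮ w (isolatedIn S w)
      ≡⟨ ℚ.*-comm (χᴬ u (isolatedIn S u)) (χᴮ w (isolatedIn S w)) ⟩
    χᴮ w (isolatedIn S w) * χᴬ u (isolatedIn S u)
      ≡⟨ cong (λ b → χᴮ w (isolatedIn S w) * χᴬ u b) (sym (isolatedIn-─ S u w uw)) ⟩
    χᴮ w (isolatedIn S w) * χᴬ u (isolatedIn (S ─ w) u) ∎
  ... | true = begin
    χᴬ u (isolatedIn S u) * χᴮ w (isolatedIn (S ─ u) w)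
      ≡⟨ cong (λ b → χᴬ u b * χᴮ w (isolatedIn (S ─ u) w)) (isolatedIn-adj S u w (∧-conicalˡ _ _ w∈S─u) uw) ⟩
    χᴬ u false * χᴮ w (isolatedIn (S ─ u) w)
      ≡⟨ across-edge u w (adj-bipartite u w uw) _ _ ⟩
    χᴮ w false * χᴬ u (isolatedIn (S ─ w) u)
      ≡⟨ cong (λ b → χᴮ w b * χᴬ u (isolatedIn (S ─ w) u)) (sym (isolatedIn-adj S w u u∈S (trans (adj-sym w u) uw))) ⟩
    χᴮ w (isolatedIn S w) * χᴬ u (isolatedIn (S ─ w) u) ∎

  ⟦∧⟧-regroup : ∀ p q x y z → ⟦ p ⟧ * x * (⟦ q ⟧ * y * z) ≡ ⟦ p ∧ q ⟧ * (x * y * z)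
  ⟦∧⟧-regroup p q x y z = begin
    ⟦ p ⟧ * x * (⟦ q ⟧ * y * z)
      ≡⟨ solve 5 (λ P Q x y z → P :* x :* (Q :* y :* z) := P :* Q :* (x :* y :* z)) refl ⟦ p ⟧ ⟦ q ⟧ x y z ⟩
    ⟦ p ⟧ * ⟦ q ⟧ * (x * y * z) ≡⟨ cong (_* (x * y * z)) (sym (⟦∧⟧ p q)) ⟩
    ⟦ p ∧ q ⟧ * (x * y * z)     ∎

  -- Expansion by the top vertex w, which is active: this is free if w ∈ A, while if w ∈ B
  -- every A-neighbour of w lies below it and is then inactive.
  arrangementSum-top : ∀ n S → arrangementSum χᴬ (suc n) S ≡
                       ∑[ w < m ] (⟦ S w ⟧ * χᴮ w (isolatedIn S w) * arrangementSum χᴬ n (S ─ w))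
  arrangementSum-top zero S = sum-cong-≗ sole
    where
    χᴬ≡χᴮ : ∀ w → χᴬ w true ≡ χᴮ w true
    χᴬ≡χᴮ w with inA w
    ... | true  = refl
    ... | false = refl
    sole : ∀ w → ⟦ S w ⟧ * χᴬ w (isolatedIn S w) * ⟦ isEmpty (S ─ w) ⟧
               ≡ ⟦ S w ⟧ * χᴮ w (isolatedIn S w) * ⟦ isEmpty (S ─ w) ⟧
    sole w = begin
      ⟦ S w ⟧ * χᴬ w (isolatedIn S w) * ⟦ isEmpty (S ─ w) ⟧ ≡⟨ regroup (χᴬ w (isolatedIn S w)) ⟩
      ⟦ S w ∧ isEmpty (S ─ w) ⟧ * χᴬ w (isolatedIn S w)
        ≡⟨ ⟦⟧*-cong (S w ∧ isEmpty (S ─ w)) (λ sole-in-S → begin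
             χᴬ w (isolatedIn S w) ≡⟨ cong (χᴬ w) (isolated sole-in-S) ⟩
             χᴬ w true             ≡⟨ χᴬ≡χᴮ w ⟩
             χᴮ w true             ≡⟨ cong (χᴮ w) (sym (isolated sole-in-S)) ⟩
             χᴮ w (isolatedIn S w) ∎) ⟩
      ⟦ S w ∧ isEmpty (S ─ w) ⟧ * χᴮ w (isolatedIn S w)      ≡⟨ sym (regroup (χᴮ w (isolatedIn S w))) ⟩
      ⟦ S w ⟧ * χᴮ w (isolatedIn S w) * ⟦ isEmpty (S ─ w) ⟧ ∎
      where
      regroup : ∀ c → ⟦ S w ⟧ * c * ⟦ isEmpty (S ─ w) ⟧ ≡ ⟦ S w ∧ isEmpty (S ─ w) ⟧ * c
      regroup c = trans (solve 3 (λ P c Q → P :* c :* Q := P :* Q :* c) refl ⟦ S w ⟧ c ⟦ isEmpty (S ─ w) ⟧)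
                        (cong (_* c) (sym (⟦∧⟧ (S w) (isEmpty (S ─ w)))))
      isolated : S w ∧ isEmpty (S ─ w) ≡ true → isolatedIn S w ≡ true
      isolated sole-in-S = sole-vertex-isolated S w (∧-conicalˡ _ _ sole-in-S) (∧-conicalʳ _ _ sole-in-S)
  arrangementSum-top (suc n) S = begin
    ∑[ u < m ] (bottom u * arrangementSum χᴬ (suc n) (S ─ u))
      ≡⟨ sum-cong-≗ (λ u → trans (cong (bottom u *_) (arrangementSum-top n (S ─ u)))
                                 (*-distribˡ-sum (bottom u) (top-after u))) ⟩
    ∑[ u < m ] ∑[ w < m ] (bottom u * top-after u w)
      ≡⟨ sum-cong-≗ (λ u → sum-cong-≗ (λ w → swap-ends u w)) ⟩
    ∑[ u < m ] ∑[ w < m ] (top w * bottom-after w u)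
      ≡⟨ ∑-comm (λ u w → top w * bottom-after w u) ⟩
    ∑[ w < m ] ∑[ u < m ] (top w * bottom-after w u)
      ≡⟨ sum-cong-≗ (λ w → sym (*-distribˡ-sum (top w) (bottom-after w))) ⟩
    ∑[ w < m ] (top w * arrangementSum χᴬ (suc n) (S ─ w)) ∎
    where
    N = arrangementSum χᴬ n
    bottom top : Fin m → ℚ
    bottom u = ⟦ S u ⟧ * χᴬ u (isolatedIn S u)
    top    w = ⟦ S w ⟧ * χᴮ w (isolatedIn S w)
    top-after bottom-after : Fin m → Fin m → ℚ
    top-after    u w = ⟦ (S ─ u) w ⟧ * χᴮ w (isolatedIn (S ─ u) w) * N ((S ─ u) ─ w)
    bottom-after w u = ⟦ (S ─ w) u ⟧ * χᴬ u (isolatedIn (S ─ w) u) * N ((S ─ w) ─ u)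
    swap-ends : ∀ u w → bottom u * top-after u w ≡ top w * bottom-after w u
    swap-ends u w = begin
      bottom u * top-after u w
        ≡⟨ ⟦∧⟧-regroup (S u) ((S ─ u) w) u-bottom w-top (N ((S ─ u) ─ w)) ⟩
      ⟦ S u ∧ (S ─ u) w ⟧ * (u-bottom * w-top * N ((S ─ u) ─ w))
        ≡⟨ ⟦⟧*-cong (S u ∧ (S ─ u) w) (λ u,w∈S → cong₂ _*_
             (exchange S u w (∧-conicalˡ (S u) ((S ─ u) w) u,w∈S) (∧-conicalʳ (S u) ((S ─ u) w) u,w∈S))
             (arrangementSum-cong χᴬ n (─-comm S u w))) ⟩
      ⟦ S u ∧ (S ─ u) w ⟧ * (w-top′ * u-bottom′ * N ((S ─ w) ─ u))
        ≡⟨ cong (λ c → ⟦ c ⟧ * (w-top′ * u-bottom′ * N ((S ─ w) ─ u))) (─-swap S u w) ⟩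
      ⟦ S w ∧ (S ─ w) u ⟧ * (w-top′ * u-bottom′ * N ((S ─ w) ─ u))
        ≡⟨ sym (⟦∧⟧-regroup (S w) ((S ─ w) u) w-top′ u-bottom′ (N ((S ─ w) ─ u))) ⟩
      top w * bottom-after w u ∎
      where
      u-bottom = χᴬ u (isolatedIn S u)
      w-top    = χᴮ w (isolatedIn (S ─ u) w)
      w-top′   = χᴮ w (isolatedIn S w)
      u-bottom′ = χᴬ u (isolatedIn (S ─ w) u)

  arrangementSum-power : ∀ x (f : Weight) → (∀ v t → f v t + χᴬ v t ≡ x * χᴬ v t + χᴮ v t) →
                         ∀ n S → arrangementSum f n S ≡ x ^ n * arrangementSum χᴬ n S
  arrangementSum-power x f local zero    S = sym (ℚ.*-identityˡ ⟦ isEmpty S ⟧)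
  arrangementSum-power x f local (suc n) S = begin
    ∑[ w < m ] (⟦ S w ⟧ * f w (isolatedIn S w) * arrangementSum f n (S ─ w))
      ≡⟨ sum-cong-≗ (λ w → cong (⟦ S w ⟧ * f w (isolatedIn S w) *_) (arrangementSum-power x f local n (S ─ w))) ⟩
    ∑[ w < m ] (⟦ S w ⟧ * f w (isolatedIn S w) * (x ^ n * N (S ─ w)))
      ≡⟨ sum-cong-≗ (λ w → solve 4 (λ a b c d → a :* b :* (c :* d) := c :* (a :* b :* d)) refl
                                   ⟦ S w ⟧ (f w (isolatedIn S w)) (x ^ n) (N (S ─ w))) ⟩
    ∑[ w < m ] (x ^ n * term f w)
      ≡⟨ sym (*-distribˡ-sum (x ^ n) (term f)) ⟩
    x ^ n * ∑[ w < m ] term f w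
      ≡⟨ cong (x ^ n *_) (+-cancelʳ N′ (∑[ w < m ] term f w) (x * N′) two-ways) ⟩
    x ^ n * (x * N′)
      ≡⟨ solve 3 (λ a b c → a :* (b :* c) := b :* a :* c) refl (x ^ n) x N′ ⟩
    x ^ suc n * N′ ∎
    where
    N = arrangementSum χᴬ n
    N′ = arrangementSum χᴬ (suc n) S
    term : Weight → Fin m → ℚ
    term g w = ⟦ S w ⟧ * g w (isolatedIn S w) * N (S ─ w)
    termwise : ∀ w → term f w + term χᴬ w ≡ x * term χᴬ w + term χᴮ w
    termwise w = begin
      ⟦ S w ⟧ * fw * Nw + ⟦ S w ⟧ * g * Nw
        ≡⟨ solve 4 (λ P a g N → P :* a :* N :+ P :* g :* N := P :* (a :+ g) :* N) refl ⟦ S w ⟧ fw g Nw ⟩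
      ⟦ S w ⟧ * (fw + g) * Nw
        ≡⟨ cong (λ c → ⟦ S w ⟧ * c * Nw) (local w (isolatedIn S w)) ⟩
      ⟦ S w ⟧ * (x * g + e) * Nw
        ≡⟨ solve 5 (λ P x g e N → P :* (x :* g :+ e) :* N := x :* (P :* g :* N) :+ P :* e :* N) refl ⟦ S w ⟧ x g e Nw ⟩
      x * (⟦ S w ⟧ * g * Nw) + ⟦ S w ⟧ * e * Nw ∎
      where
      fw = f w (isolatedIn S w)
      g  = χᴬ w (isolatedIn S w)
      e  = χᴮ w (isolatedIn S w)
      Nw = N (S ─ w)
    two-ways : ∑[ w < m ] term f w + N′ ≡ x * N′ + N′
    two-ways = begin
      ∑[ w < m ] term f w + ∑[ w < m ] term χᴬ w
        ≡⟨ sym (∑-distrib-+ (term f) (term χᴬ)) ⟩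
      ∑[ w < m ] (term f w + term χᴬ w)
        ≡⟨ sum-cong-≗ termwise ⟩
      ∑[ w < m ] (x * term χᴬ w + term χᴮ w)
        ≡⟨ ∑-distrib-+ (λ w → x * term χᴬ w) (term χᴮ) ⟩
      ∑[ w < m ] (x * term χᴬ w) + ∑[ w < m ] term χᴮ w
        ≡⟨ cong₂ _+_ (sym (*-distribˡ-sum x (term χᴬ))) (sym (arrangementSum-top n S)) ⟩
      x * N′ + N′ ∎

module Activities (H : BipGraph) where

  side : Fin (nV H) → Fin (a H) ⊎ Fin (b H)
  side = splitAt (a H)

  side-vA : ∀ i → side (vA H i) ≡ inj₁ i
  side-vA i = splitAt-↑ˡ (a H) i (b H)

  side-vB : ∀ j → side (vB H j) ≡ inj₂ j
  side-vB j = splitAt-↑ʳ (a H) (b H) j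

  isA : Fin (a H) ⊎ Fin (b H) → Bool
  isA = [ const true , const false ]′

  edge : Fin (a H) ⊎ Fin (b H) → Fin (a H) ⊎ Fin (b H) → Bool
  edge (inj₁ i) (inj₂ j) = E H i j
  edge (inj₂ j) (inj₁ i) = E H i j
  edge _        _        = false

  edge-sym : ∀ s t → edge s t ≡ edge t s
  edge-sym (inj₁ _) (inj₁ _) = refl
  edge-sym (inj₁ _) (inj₂ _) = refl
  edge-sym (inj₂ _) (inj₁ _) = refl
  edge-sym (inj₂ _) (inj₂ _) = refl

  edge-bipartite : ∀ s t → edge s t ≡ true → isA s ≡ not (isA t)
  edge-bipartite (inj₁ _) (inj₂ _) _  = refl
  edge-bipartite (inj₂ _) (inj₁ _) _  = refl
  edge-bipartite (inj₁ _) (inj₁ _) ()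
  edge-bipartite (inj₂ _) (inj₂ _) ()

  inA : Fin (nV H) → Bool
  inA = isA ∘ side

  adj : Fin (nV H) → Fin (nV H) → Bool
  adj u v = edge (side u) (side v)

  open Arrangements adj
  open Bipartite inA adj (λ u v → edge-sym (side u) (side v)) (λ u v → edge-bipartite (side u) (side v))
  open Ranking adj

  active-vA : ∀ π i → active π (vA H i) ≡ intActive H π i
  active-vA π i = begin
    active π (vA H i)
      ≡⟨ every-++ {a H} (λ u → if adj (vA H i) u then lookup π u <ᵇ lookup π (vA H i) else true) ⟩
    every (λ i′ → if adj (vA H i) (vA H i′) then lookup π (vA H i′) <ᵇ lookup π (vA H i) else true) ∧
    every (λ j → if adj (vA H i) (vB H j) then lookup π (vB H j) <ᵇ lookup π (vA H i) else true)
      ≡⟨ cong₂ _∧_ (every-true (λ i′ → cong (λ e → if e then lookup π (vA H i′) <ᵇ lookup π (vA H i) else true)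
                                              (cong₂ edge (side-vA i) (side-vA i′))))
                   (every-cong (λ j → cong (λ e → if e then lookup π (vB H j) <ᵇ lookup π (vA H i) else true)
                                           (cong₂ edge (side-vA i) (side-vB j)))) ⟩
    every (λ j → if E H i j then lookup π (vB H j) <ᵇ lookup π (vA H i) else true)
      ≡⟨ sym (allB≡every (λ j → if E H i j then lookup π (vB H j) <ᵇ lookup π (vA H i) else true)) ⟩
    intActive H π i ∎

  active-vB : ∀ π j → active π (vB H j) ≡ extActive H π j
  active-vB π j = begin
    active π (vB H j)
      ≡⟨ every-++ {a H} (λ u → if adj (vB H j) u then lookup π u <ᵇ lookup π (vB H j) else true) ⟩
    every (λ i → if adj (vB H j) (vA H i) then lookup π (vA H i) <ᵇ lookup π (vB H j) else true) ∧
    every (λ j′ → if adj (vB H j) (vB H j′) then lookup π (vB H j′) <ᵇ lookup π (vB H j) else true)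
      ≡⟨ cong₂ _∧_ (every-cong (λ i → cong (λ e → if e then lookup π (vA H i) <ᵇ lookup π (vB H j) else true)
                                           (cong₂ edge (side-vB j) (side-vA i))))
                   (every-true (λ j′ → cong (λ e → if e then lookup π (vB H j′) <ᵇ lookup π (vB H j) else true)
                                              (cong₂ edge (side-vB j) (side-vB j′)))) ⟩
    every (λ i → if E H i j then lookup π (vA H i) <ᵇ lookup π (vB H j) else true) ∧ true
      ≡⟨ ∧-identityʳ _ ⟩
    every (λ i → if E H i j then lookup π (vA H i) <ᵇ lookup π (vB H j) else true)
      ≡⟨ sym (allB≡every (λ i → if E H i j then lookup π (vA H i) <ᵇ lookup π (vB H j) else true)) ⟩
    extActive H π j ∎

  activityWeight : ℚ → Weight
  activityWeight x v t = if t then x else (if inA v then 1ℚ else x - 1ℚ)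

  activityWeight-local : ∀ x v t → activityWeight x v t + χᴬ v t ≡ x * χᴬ v t + χᴮ v t
  activityWeight-local x v t with inA v | t
  ... | true  | true  = solve 1 (λ x → x :+ con 1ℚ := x :* con 1ℚ :+ con 1ℚ) refl x
  ... | true  | false = solve 1 (λ x → con 1ℚ :+ con 0ℚ := x :* con 0ℚ :+ con 1ℚ) refl x
  ... | false | true  = solve 1 (λ x → x :+ con 1ℚ := x :* con 1ℚ :+ con 1ℚ) refl x
  ... | false | false = solve 1 (λ x → (x :- con 1ℚ) :+ con 1ℚ := x :* con 1ℚ :+ con 0ℚ) refl x

  summand≡∏ : ∀ x y → y * (x - 1ℚ) ≡ x → ∀ π →
              x ^ ia H π * y ^ ea H π * (x - 1ℚ) ^ b H ≡ ∏ (λ v → activityWeight x v (active π v))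
  summand≡∏ x y y[x-1]≡x π = sym (begin
    ∏ (λ v → ω v (active π v))
      ≡⟨ ∏-++ {a H} (λ v → ω v (active π v)) ⟩
    ∏ (λ i → ω (vA H i) (active π (vA H i))) * ∏ (λ j → ω (vB H j) (active π (vB H j)))
      ≡⟨ cong₂ _*_ (∏-cong (λ i → trans (cong (ω (vA H i)) (active-vA π i)) (ωᴬ i (intActive H π i))))
                   (∏-cong (λ j → trans (cong (ω (vB H j)) (active-vB π j)) (ωᴮ j (extActive H π j)))) ⟩
    ∏ x-or-1 * ∏ (λ j → y-or-1 j * (x - 1ℚ))
      ≡⟨ cong (∏ x-or-1 *_) (∏-distrib-* y-or-1 (λ _ → x - 1ℚ)) ⟩
    ∏ x-or-1 * (∏ y-or-1 * ∏ {b H} (λ _ → x - 1ℚ))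
      ≡⟨ cong₂ _*_ (sym (^-count x (intActive H π)))
                   (cong₂ _*_ (sym (^-count y (extActive H π))) (∏-const (b H) (x - 1ℚ))) ⟩
    x ^ count (intActive H π) * (y ^ count (extActive H π) * (x - 1ℚ) ^ b H)
      ≡⟨ cong₂ (λ k l → x ^ k * (y ^ l * (x - 1ℚ) ^ b H))
               (sym (countB≡count (intActive H π))) (sym (countB≡count (extActive H π))) ⟩
    x ^ ia H π * (y ^ ea H π * (x - 1ℚ) ^ b H)
      ≡⟨ sym (ℚ.*-assoc (x ^ ia H π) (y ^ ea H π) ((x - 1ℚ) ^ b H)) ⟩
    x ^ ia H π * y ^ ea H π * (x - 1ℚ) ^ b H ∎)
    where
    ω = activityWeight x
    x-or-1 : Fin (a H) → ℚ
    x-or-1 i = if intActive H π i then x else 1ℚ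
    y-or-1 : Fin (b H) → ℚ
    y-or-1 j = if extActive H π j then y else 1ℚ
    ωᴬ : ∀ i t → ω (vA H i) t ≡ (if t then x else 1ℚ)
    ωᴬ i true  = refl
    ωᴬ i false = cong (λ s → if isA s then 1ℚ else x - 1ℚ) (side-vA i)
    ωᴮ : ∀ j t → ω (vB H j) t ≡ (if t then y else 1ℚ) * (x - 1ℚ)
    ωᴮ j true  = sym y[x-1]≡x
    ωᴮ j false = trans (cong (λ s → if isA s then 1ℚ else x - 1ℚ) (side-vB j)) (sym (ℚ.*-identityˡ (x - 1ℚ)))

  ia≡a⇒every : ∀ π → ia H π ≡ a H → every (intActive H π) ≡ true
  ia≡a⇒every π ia≡a = count≡n⇒every (intActive H π) (trans (sym (countB≡count (intActive H π))) ia≡a)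

  every⇒ia≡a : ∀ π → every (intActive H π) ≡ true → ia H π ≡ a H
  every⇒ia≡a π all-active = trans (countB≡count (intActive H π)) (every⇒count≡n (intActive H π) all-active)

  every⇒ea≡isolB : ∀ π → every (intActive H π) ≡ true → ea H π ≡ isolB H
  every⇒ea≡isolB π all-active = begin
    countB (extActive H π) ≡⟨ countB≡count (extActive H π) ⟩
    count (extActive H π)  ≡⟨ count-cong extActive≡isolated ⟩
    count isolated         ≡⟨ sym (countB≡count isolated) ⟩
    isolB H                ∎
    where
    isolated : Fin (b H) → Bool
    isolated j = allB (λ i → not (E H i j))
    A-above : ∀ i j → E H i j ≡ true → lookup π (vB H j) <ᵇ lookup π (vA H i) ≡ true
    A-above i j eij = subst (λ e → (if e then lookup π (vB H j) <ᵇ lookup π (vA H i) else true) ≡ true) eij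
      (every-elim (trans (sym (allB≡every (λ j → if E H i j then lookup π (vB H j) <ᵇ lookup π (vA H i) else true)))
                         (every-elim all-active i)) j)
    extActive≡isolated : ∀ j → extActive H π j ≡ isolated j
    extActive≡isolated j = begin
      extActive H π j              ≡⟨ allB≡every B-above ⟩
      every B-above                ≡⟨ every-cong no-edge ⟩
      every (λ i → not (E H i j))  ≡⟨ sym (allB≡every (λ i → not (E H i j))) ⟩
      isolated j                   ∎
      where
      B-above : Fin (a H) → Bool
      B-above i = if E H i j then lookup π (vA H i) <ᵇ lookup π (vB H j) else true
      no-edge : ∀ i → B-above i ≡ not (E H i j)
      no-edge i with E H i j in eij
      ... | false = refl
      ... | true  = <ᵇ-asym (lookup π (vB H j)) (lookup π (vA H i)) (A-above i j eij)

  alternating? : ∀ π → Dec (ia H π ≡ a H × ea H π ≡ isolB H)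
  alternating? π = (ia H π ℕ.≟ a H) ×-dec (ea H π ℕ.≟ isolB H)

  alternating?≡every : ∀ π → does (alternating? π) ≡ every (intActive H π)
  alternating?≡every π with every (intActive H π) in all-active
  ... | true  = cong₂ _∧_ (dec-true (ia H π ℕ.≟ a H) (every⇒ia≡a π all-active))
                          (dec-true (ea H π ℕ.≟ isolB H) (every⇒ea≡isolB π all-active))
  ... | false = cong₂ _∧_ (dec-false (ia H π ℕ.≟ a H)
                            (λ ia≡a → contradiction (trans (sym (ia≡a⇒every π ia≡a)) all-active) λ ()))
                          refl

  ⟦alternating?⟧≡∏ : ∀ π → ⟦ does (alternating? π) ⟧ ≡ ∏ (λ v → χᴬ v (active π v))
  ⟦alternating?⟧≡∏ π = sym (begin
    ∏ (λ v → χᴬ v (active π v))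
      ≡⟨ ∏-++ {a H} (λ v → χᴬ v (active π v)) ⟩
    ∏ (λ i → χᴬ (vA H i) (active π (vA H i))) * ∏ (λ j → χᴬ (vB H j) (active π (vB H j)))
      ≡⟨ cong₂ _*_ (∏-cong (λ i → cong₂ (λ s t → if isA s then ⟦ t ⟧ else 1ℚ) (side-vA i) (active-vA π i)))
                   (∏-cong (λ j → cong (λ s → if isA s then ⟦ active π (vB H j) ⟧ else 1ℚ) (side-vB j))) ⟩
    ∏ (λ i → ⟦ intActive H π i ⟧) * ∏ {b H} (λ _ → 1ℚ)
      ≡⟨ cong₂ _*_ (∏-⟦⟧ (intActive H π)) (∏-const (b H) 1ℚ) ⟩
    ⟦ every (intActive H π) ⟧ * 1ℚ ^ b H
      ≡⟨ cong₂ _*_ (cong ⟦_⟧ (sym (alternating?≡every π))) (1^n≡1 (b H)) ⟩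
    ⟦ does (alternating? π) ⟧ * 1ℚ
      ≡⟨ ℚ.*-identityʳ _ ⟩
    ⟦ does (alternating? π) ⟧ ∎)

  #alternating : ℚ
  #alternating = fromℕ (length (filter alternating? (perms (nV H))))

  #alternating≡∑ : #alternating ≡ ∑[ π ∈ perms (nV H) ] ∏ (λ v → χᴬ v (active π v))
  #alternating≡∑ = begin
    #alternating
      ≡⟨ fromℕ-length (filter alternating? (perms (nV H))) ⟩
    ∑[ π ∈ filter alternating? (perms (nV H)) ] 1ℚ
      ≡⟨ ∑∈-filter alternating? (λ _ → 1ℚ) (perms (nV H)) ⟩
    ∑[ π ∈ perms (nV H) ] (⟦ does (alternating? π) ⟧ * 1ℚ)
      ≡⟨ ∑∈-cong (perms (nV H)) (λ π → trans (ℚ.*-identityʳ _) (⟦alternating?⟧≡∏ π)) ⟩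
    ∑[ π ∈ perms (nV H) ] ∏ (λ v → χᴬ v (active π v)) ∎

  Ttilde-numerator : ∀ x y → y * (x - 1ℚ) ≡ x →
    ∑[ π ∈ perms (nV H) ] (x ^ ia H π * y ^ ea H π) * (x - 1ℚ) ^ b H ≡ #alternating * x ^ nV H
  Ttilde-numerator x y y[x-1]≡x = begin
    ∑[ π ∈ perms (nV H) ] (x ^ ia H π * y ^ ea H π) * (x - 1ℚ) ^ b H
      ≡⟨ sym (∑∈-*ʳ ((x - 1ℚ) ^ b H) (λ π → x ^ ia H π * y ^ ea H π) (perms (nV H))) ⟩
    ∑[ π ∈ perms (nV H) ] (x ^ ia H π * y ^ ea H π * (x - 1ℚ) ^ b H)
      ≡⟨ ∑∈-cong (perms (nV H)) (summand≡∏ x y y[x-1]≡x) ⟩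
    ∑[ π ∈ perms (nV H) ] ∏ (λ v → activityWeight x v (active π v))
      ≡⟨ ∑-perms≡arrangementSum (activityWeight x) ⟩
    arrangementSum (activityWeight x) (nV H) full
      ≡⟨ arrangementSum-power x (activityWeight x) (activityWeight-local x) (nV H) full ⟩
    x ^ nV H * arrangementSum χᴬ (nV H) full
      ≡⟨ cong (x ^ nV H *_) (trans (sym (∑-perms≡arrangementSum χᴬ)) (sym #alternating≡∑)) ⟩
    x ^ nV H * #alternating
      ≡⟨ ℚ.*-comm (x ^ nV H) #alternating ⟩
    #alternating * x ^ nV H ∎

Ttilde-on-hyperbola : (H : BipGraph) → (x : ℚ) → x ≢ 1ℚ →
                      Ttilde H x (x * inv0 (x - 1ℚ)) ≡ alt H * ((x ^ nV H) * inv0 ((x - 1ℚ) ^ b H))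
Ttilde-on-hyperbola H x x≢1 = begin
  1/m! * ∑[ π ∈ perms (nV H) ] (x ^ ia H π * y ^ ea H π)
    ≡⟨ cong (1/m! *_) (p*r≡q⇒p≡q*inv0r (^-≢0 x-1≢0 (b H)) (Ttilde-numerator x y y[x-1]≡x)) ⟩
  1/m! * (#alternating * x ^ nV H * inv0 ((x - 1ℚ) ^ b H))
    ≡⟨ solve 4 (λ M C X I → M :* (C :* X :* I) := M :* C :* (X :* I)) refl
               1/m! #alternating (x ^ nV H) (inv0 ((x - 1ℚ) ^ b H)) ⟩
  1/m! * #alternating * (x ^ nV H * inv0 ((x - 1ℚ) ^ b H)) ∎
  where
  open Activities H
  1/m! = inv0 (fromℕ (nV H !))
  y = x * inv0 (x - 1ℚ)
  x-1≢0 : x - 1ℚ ≢ 0ℚ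
  x-1≢0 x-1≡0 = x≢1 (begin
    x           ≡⟨ solve 1 (λ x → x := (x :- con 1ℚ) :+ con 1ℚ) refl x ⟩
    x - 1ℚ + 1ℚ ≡⟨ cong (_+ 1ℚ) x-1≡0 ⟩
    0ℚ + 1ℚ     ≡⟨ ℚ.+-identityˡ 1ℚ ⟩
    1ℚ          ∎)
  y[x-1]≡x : y * (x - 1ℚ) ≡ x
  y[x-1]≡x = begin
    x * inv0 (x - 1ℚ) * (x - 1ℚ)   ≡⟨ ℚ.*-assoc x (inv0 (x - 1ℚ)) (x - 1ℚ) ⟩
    x * (inv0 (x - 1ℚ) * (x - 1ℚ)) ≡⟨ cong (x *_) (trans (ℚ.*-comm (inv0 (x - 1ℚ)) (x - 1ℚ))
                                                         (inv0-inverseʳ (x - 1ℚ) x-1≢0)) ⟩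
    x * 1ℚ                         ≡⟨ ℚ.*-identityʳ x ⟩
    x                              ∎

mainTheorem13 : (H : BipGraph) →
    ((x : ℚ) → x ≢ 1ℚ →
      Ttilde H x (x * inv0 (x - 1ℚ)) ≡ alt H * ((x ^ nV H) * inv0 ((x - 1ℚ) ^ b H)))
    × (Ttilde H (fromℕ 2) (fromℕ 2) ≡ alt H * (fromℕ 2 ^ nV H))
mainTheorem13 H = Ttilde-on-hyperbola H , (begin
  -- 2 · inv0 (2 − 1) and 2 − 1 compute to 2 and 1.
  Ttilde H (fromℕ 2) (fromℕ 2)                 ≡⟨ Ttilde-on-hyperbola H (fromℕ 2) (λ ()) ⟩
  alt H * (fromℕ 2 ^ nV H * inv0 (1ℚ ^ b H))   ≡⟨ cong (λ p → alt H * (fromℕ 2 ^ nV H * inv0 p)) (1^n≡1 (b H)) ⟩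
  alt H * (fromℕ 2 ^ nV H * 1ℚ)                ≡⟨ cong (alt H *_) (ℚ.*-identityʳ (fromℕ 2 ^ nV H)) ⟩
  alt H * fromℕ 2 ^ nV H                       ∎)
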